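{- Let $r\ge 2$ and $n\ge 4$. For every vertex $(x,y)$ of $\mathcal{D}_{n-1}$ we have $\pi_n(rx+(r-1)y)=\pi_{n-1}(x+y)$.
   Context: Define integers $c_1=0$, $c_2=1$, $c_n=rc_{n-1}-c_{n-2}$ for $n\ge 3$. For coprime nonnegative integers $a,b$, the maximal Dyck path $\mathcal{P}(a,b)$ is the lattice path from $(0,0)$ to $(a,b)$ using unit north and east steps that never passes strictly above the segment from $(0,0)$ to $(a,b)$ and whose height at each vertex is maximal among such paths. For $n\ge3$, $\mathcal{D}_n=\mathcal{P}(c_{n-1}-c_{n-2},c_{n-2})$; it has $c_{n-1}$ edges, and $\mathcal{D}_{n-1}$ is a prefix of $\mathcal{D}_n$. For $0\le i\le c_{n-1}$ let $w_i=(x,i-x)$ be the vertex of $\mathcal{D}_n$ reached after $i$ steps, and define $\pi_n(i)=x\,c_{n-2}-(i-x)(c_{n-1}-c_{n-2})$. -}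

module Defs where

open import Data.Nat as ℕ using (ℕ; zero; suc; _≤_; _∸_)
open import Data.Integer as ℤ using (ℤ; +_; -[1+_]; _-_; ∣_∣)
open import Data.List using (List; []; _∷_; take; length)
open import Data.Product using (_×_; _,_; proj₁; proj₂)
open import Relation.Binary.PropositionalEquality using (_≡_)

-- The sequence c_n (depending on the parameter r), as integers.
-- c 0 = -1 is the value forced by running the recurrence backwards
-- (c_2 = r c_1 - c_0); only c_n for n ≥ 1 matter.
c : ℕ → ℕ → ℤ
c r 0 = -[1+ 0 ]
c r 1 = + 0
c r (suc (suc n)) = (+ r) ℤ.* c r (suc n) - c r n

data Step : Set where
  N E : Step

Path : Set
Path = List Step

pos : Path → ℕ × ℕ
pos [] = 0 , 0
pos (N ∷ p) = proj₁ (pos p) , suc (proj₂ (pos p))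
pos (E ∷ p) = suc (proj₁ (pos p)) , proj₂ (pos p)

vertex : Path → ℕ → ℕ × ℕ
vertex p i = pos (take i p)

height : Path → ℕ → ℕ
height p i = proj₂ (vertex p i)

IsDyck : ℕ → ℕ → Path → Set
IsDyck a b p =
  (pos p ≡ (a , b)) × (∀ i → i ≤ length p → a ℕ.* proj₂ (vertex p i) ≤ b ℕ.* proj₁ (vertex p i))

IsMaxDyck : ℕ → ℕ → Path → Set
IsMaxDyck a b p =
  IsDyck a b p × (∀ q → IsDyck a b q → ∀ i → i ≤ length p → height q i ≤ height p i)

-- Dimensions of 𝒟_n = 𝒫(c_{n-1} - c_{n-2}, c_{n-2}) (these are nonnegative for r ≥ 2).
Dx : ℕ → ℕ → ℕ
Dx r n = ∣ c r (n ∸ 1) - c r (n ∸ 2) ∣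

Dy : ℕ → ℕ → ℕ
Dy r n = ∣ c r (n ∸ 2) ∣

-- π_n(i) = x c_{n-2} - (i-x)(c_{n-1} - c_{n-2}), where w_i = (x, i-x) is the
-- vertex of the path p (intended to be 𝒟_n) reached after i steps.
π : ℕ → ℕ → Path → ℕ → ℤ
π r n p i =
  (+ proj₁ (vertex p i)) ℤ.* c r (n ∸ 2)
  - ((+ i) - (+ proj₁ (vertex p i))) ℤ.* (c r (n ∸ 1) - c r (n ∸ 2))

-- After i steps the maximal Dyck path 𝒫(a,b) has height ⌊b i/(a+b)⌋: the Dyck condition
-- bounds every height by this floor, and the greedy path, stepping north whenever it
-- stays weakly below the diagonal, attains it.  So 𝒟_n has height ⌊c_{n-2} i/c_{n-1}⌋.
-- Let (x,y) be the vertex of 𝒟_{n-1} after j = x+y steps, so y = ⌊c_{n-3} j/c_{n-2}⌋, and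
-- let k = rx+(r-1)y, so k + y = rj.  From c_{n-1} + c_{n-3} = r c_{n-2} we get
-- c_{n-2} k = c_{n-1} j + (c_{n-3} j mod c_{n-2}), hence 𝒟_n has height j after k steps.
-- With that, π_n(k) - π_{n-1}(j) = (k + y - rj) c_{n-2} = 0.
module Submission where

open import Defs
open import Data.Nat using (ℕ; zero; suc; _≤_; _<_; _+_; _*_; _∸_; _≤?_; NonZero; >-nonZero; >-nonZero⁻¹; z≤n; s≤s; s≤s⁻¹)
open import Data.Integer as ℤ using (ℤ; +_; -[1+_]; ∣_∣)
import Data.Integer.Properties as ℤP
open import Data.Nat.Properties
open import Data.Nat.DivMod using (_/_; _%_; m<n*o⇒m/o<n; m*n/n≡m; /-monoˡ-≤; /-congˡ; /-congʳ; m≡m%n+[m/n]*n; m%n<n)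
import Data.Nat.Tactic.RingSolver as ℕ-Solver
import Data.Integer.Tactic.RingSolver as ℤ-Solver
open import Data.List using ([]; _∷_; take; length)
open import Data.List.Properties using (length-take; take-all)
open import Data.Product using (_×_; _,_; proj₁; proj₂)
open import Relation.Binary.PropositionalEquality
  using (_≡_; refl; sym; trans; cong; cong₂; subst; subst₂; module ≡-Reasoning)
open import Relation.Nullary using (yes; no)

m*n≤o⇒m≤o/n : ∀ {m n o} .{{_ : NonZero n}} → m * n ≤ o → m ≤ o / n
m*n≤o⇒m≤o/n {m} {n} {o} m*n≤o = begin
    m          ≡⟨ m*n/n≡m m n ⟨
    m * n / n  ≤⟨ /-monoˡ-≤ n m*n≤o ⟩
    o / n      ∎
  where open ≤-Reasoning

q*n≤m<[1+q]*n⇒m/n≡q : ∀ {m n q} .{{_ : NonZero n}} → q * n ≤ m → m < suc q * n → m / n ≡ q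
q*n≤m<[1+q]*n⇒m/n≡q lo hi = ≤-antisym (s≤s⁻¹ (m<n*o⇒m/o<n hi)) (m*n≤o⇒m≤o/n lo)

pos-sum : ∀ p → proj₁ (pos p) + proj₂ (pos p) ≡ length p
pos-sum []      = refl
pos-sum (N ∷ p) = trans (+-suc (proj₁ (pos p)) (proj₂ (pos p))) (cong suc (pos-sum p))
pos-sum (E ∷ p) = cong suc (pos-sum p)

vertex-sum : ∀ p {i} → i ≤ length p → proj₁ (vertex p i) + proj₂ (vertex p i) ≡ i
vertex-sum p {i} i≤|p| = trans (pos-sum (take i p)) (trans (length-take i p) (m≤n⇒m⊓n≡m i≤|p|))

dyck-length : ∀ {a b p} → IsDyck a b p → length p ≡ a + b
dyck-length {p = p} (pos≡ , _) = trans (sym (pos-sum p)) (cong (λ w → proj₁ w + proj₂ w) pos≡)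

a*y≤b*x⇒y*[a+b]≤b*[x+y] : ∀ {a b x y} → a * y ≤ b * x → y * (a + b) ≤ b * (x + y)
a*y≤b*x⇒y*[a+b]≤b*[x+y] {a} {b} {x} {y} below = begin
    y * (a + b)    ≡⟨ ℕ-Solver.solve (a ∷ b ∷ y ∷ []) ⟩
    a * y + b * y  ≤⟨ +-monoˡ-≤ (b * y) below ⟩
    b * x + b * y  ≡⟨ *-distribˡ-+ b x y ⟨
    b * (x + y)    ∎
  where open ≤-Reasoning

module Greedy (a b : ℕ) where

  -- (x, y) is weakly below the diagonal, while (x - 1, y + 1) is strictly above it.
  Tight : ℕ × ℕ → Set
  Tight w = a * proj₂ w ≤ b * proj₁ w × b * proj₁ w < a * suc (proj₂ w) + b

  _⊕_ : ℕ × ℕ → ℕ × ℕ → ℕ × ℕ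
  w ⊕ v = proj₁ w + proj₁ v , proj₂ w + proj₂ v

  tight-⊕-origin : ∀ {w} → Tight w → Tight (w ⊕ (0 , 0))
  tight-⊕-origin {x , y} = subst Tight (cong₂ _,_ (sym (+-identityʳ x)) (sym (+-identityʳ y)))

  greedy : ℕ → ℕ × ℕ → Path
  greedy zero    _       = []
  greedy (suc f) (x , y) with a * suc y ≤? b * x
  ... | yes _ = N ∷ greedy f (x , suc y)
  ... | no  _ = E ∷ greedy f (suc x , y)

  greedy-length : ∀ f w → length (greedy f w) ≡ f
  greedy-length zero    _       = refl
  greedy-length (suc f) (x , y) with a * suc y ≤? b * x
  ... | yes _ = cong suc (greedy-length f (x , suc y))
  ... | no  _ = cong suc (greedy-length f (suc x , y))

  greedy-tight : ∀ f w i → Tight w → Tight (w ⊕ vertex (greedy f w) i)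
  greedy-tight f       w zero    t = tight-⊕-origin t
  greedy-tight zero    w (suc i) t = tight-⊕-origin t
  greedy-tight (suc f) (x , y) (suc i) (below , tight) with a * suc y ≤? b * x
  ... | yes north = subst Tight (cong (x + proj₁ v ,_) (sym (+-suc y (proj₂ v))))
                      (greedy-tight f (x , suc y) i
                        (north , <-≤-trans tight (+-monoˡ-≤ b (*-monoʳ-≤ a (n≤1+n (suc y))))))
    where
    v : ℕ × ℕ
    v = vertex (greedy f (x , suc y)) i
  ... | no  east  = subst Tight (cong (_, y + proj₂ v) (sym (+-suc x (proj₁ v))))
                      (greedy-tight f (suc x , y) i
                        (≤-trans below (*-monoʳ-≤ b (n≤1+n x)) , east′))
    where
    v : ℕ × ℕ
    v = vertex (greedy f (suc x , y)) i
    east′ : b * suc x < a * suc y + b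
    east′ = begin-strict
      b * suc x      ≡⟨ *-suc b x ⟩
      b + b * x      <⟨ +-monoʳ-< b (≰⇒> east) ⟩
      b + a * suc y  ≡⟨ +-comm b (a * suc y) ⟩
      a * suc y + b  ∎
      where open ≤-Reasoning

  module _ .{{_ : NonZero (a + b)}} where

    tight-height : ∀ {w} → Tight w → b * (proj₁ w + proj₂ w) / (a + b) ≡ proj₂ w
    tight-height {x , y} (below , tight) = q*n≤m<[1+q]*n⇒m/n≡q (a*y≤b*x⇒y*[a+b]≤b*[x+y] {a} {b} below) (begin-strict
        b * (x + y)            ≡⟨ *-distribˡ-+ b x y ⟩
        b * x + b * y          <⟨ +-monoˡ-< (b * y) tight ⟩
        a * suc y + b + b * y  ≡⟨ ℕ-Solver.solve (a ∷ b ∷ y ∷ []) ⟩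
        suc y * (a + b)        ∎)
      where open ≤-Reasoning

    path : Path
    path = greedy (a + b) (0 , 0)

    path-tight : ∀ i → Tight (vertex path i)
    path-tight i = greedy-tight (a + b) (0 , 0) i
      ( ≤-reflexive (trans (*-zeroʳ a) (sym (*-zeroʳ b)))
      , subst₂ _<_ (sym (*-zeroʳ b)) (cong (_+ b) (sym (*-identityʳ a))) (>-nonZero⁻¹ (a + b)))

    path-height : ∀ {i} → i ≤ a + b → height path i ≡ b * i / (a + b)
    path-height {i} i≤s = begin
        height path i                                            ≡⟨ tight-height (path-tight i) ⟨
        b * (proj₁ (vertex path i) + height path i) / (a + b)  ≡⟨ cong (λ m → b * m / (a + b)) (vertex-sum path i≤|path|) ⟩
        b * i / (a + b)                                          ∎
      where
      open ≡-Reasoning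
      i≤|path| : i ≤ length path
      i≤|path| = subst (i ≤_) (sym (greedy-length (a + b) (0 , 0))) i≤s

    path-end : pos path ≡ (a , b)
    path-end = cong₂ _,_ (+-cancelʳ-≡ y x a (trans x+y≡s (cong (λ z → a + z) (sym y≡b)))) y≡b
      where
      open ≡-Reasoning
      x y : ℕ
      x = proj₁ (pos path)
      y = proj₂ (pos path)
      end-tight : Tight (pos path)
      end-tight = subst Tight (cong pos (take-all (a + b) path (≤-reflexive (greedy-length (a + b) (0 , 0)))))
                    (path-tight (a + b))
      x+y≡s : x + y ≡ a + b
      x+y≡s = trans (pos-sum path) (greedy-length (a + b) (0 , 0))
      y≡b : y ≡ b
      y≡b = begin
        y                        ≡⟨ tight-height end-tight ⟨
        b * (x + y) / (a + b)    ≡⟨ cong (λ m → b * m / (a + b)) x+y≡s ⟩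
        b * (a + b) / (a + b)    ≡⟨ m*n/n≡m b (a + b) ⟩
        b                        ∎

    path-dyck : IsDyck a b path
    path-dyck = path-end , λ i _ → proj₁ (path-tight i)

maxDyck-height : ∀ {a b p} .{{_ : NonZero (a + b)}} → IsMaxDyck a b p →
                 ∀ {i} → i ≤ a + b → height p i ≡ b * i / (a + b)
maxDyck-height {a} {b} {p} (dyck@(_ , below) , maximal) {i} i≤s = ≤-antisym upper lower
  where
  i≤|p| : i ≤ length p
  i≤|p| = subst (i ≤_) (sym (dyck-length dyck)) i≤s
  upper : height p i ≤ b * i / (a + b)
  upper = subst (λ m → height p i ≤ b * m / (a + b)) (vertex-sum p i≤|p|)
            (m*n≤o⇒m≤o/n (a*y≤b*x⇒y*[a+b]≤b*[x+y] {a} {b} (below i i≤|p|)))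
  lower : b * i / (a + b) ≤ height p i
  lower = subst (_≤ height p i) (Greedy.path-height a b i≤s)
            (maximal (Greedy.path a b) (Greedy.path-dyck a b) i i≤|p|)

-- cℕ r n is c_{n+1}; the truncated subtraction is exact when r ≥ 2 (see c≡cℕ).
cℕ : ℕ → ℕ → ℕ
cℕ r 0             = 0
cℕ r 1             = 1
cℕ r (suc (suc n)) = r * cℕ r (suc n) ∸ cℕ r n

+m-+n≡+[m∸n] : ∀ {m n} → n ≤ m → + m ℤ.- + n ≡ + (m ∸ n)
+m-+n≡+[m∸n] {m} {n} n≤m = trans (ℤP.m-n≡m⊖n m n) (ℤP.⊖-≥ n≤m)

module Sequence {r : ℕ} (2≤r : 2 ≤ r) where

  m+m≤r*m : ∀ m → m + m ≤ r * m
  m+m≤r*m m = subst (_≤ r * m) (cong (λ z → m + z) (+-identityʳ m)) (*-monoˡ-≤ m 2≤r)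

  cℕ-mono : ∀ n → cℕ r n ≤ cℕ r (suc n)
  cℕ-mono zero    = z≤n
  cℕ-mono (suc n) = begin
      u                      ≡⟨ m+n∸n≡m u u ⟨
      u + u ∸ u              ≤⟨ ∸-mono (m+m≤r*m u) (cℕ-mono n) ⟩
      r * u ∸ cℕ r n         ∎
    where
    open ≤-Reasoning
    u : ℕ
    u = cℕ r (suc n)

  cℕ-pos : ∀ n → 0 < cℕ r (suc n)
  cℕ-pos zero    = ≤-refl
  cℕ-pos (suc n) = ≤-trans (cℕ-pos n) (cℕ-mono (suc n))

  cℕ-nonZero : ∀ n → NonZero (cℕ r (suc n))
  cℕ-nonZero n = >-nonZero (cℕ-pos n)

  cℕ-≤-r* : ∀ n → cℕ r n ≤ r * cℕ r (suc n)
  cℕ-≤-r* n = ≤-trans (cℕ-mono n) (≤-trans (m≤m+n _ _) (m+m≤r*m (cℕ r (suc n))))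

  cℕ-rec : ∀ n → cℕ r (suc (suc n)) + cℕ r n ≡ r * cℕ r (suc n)
  cℕ-rec n = m∸n+n≡m (cℕ-≤-r* n)

  c≡cℕ : ∀ n → c r (suc n) ≡ + cℕ r n
  c≡cℕ zero          = refl
  c≡cℕ (suc zero)    = cong (ℤ._- -[1+ 0 ]) (ℤP.*-zeroʳ (+ r))
  c≡cℕ (suc (suc n)) = begin
      + r ℤ.* c r (suc (suc n)) ℤ.- c r (suc n)     ≡⟨ cong₂ (λ u v → + r ℤ.* u ℤ.- v) (c≡cℕ (suc n)) (c≡cℕ n) ⟩
      + r ℤ.* + cℕ r (suc n) ℤ.- + cℕ r n           ≡⟨ cong (ℤ._- + cℕ r n) (ℤP.pos-* r (cℕ r (suc n))) ⟨
      + (r * cℕ r (suc n)) ℤ.- + cℕ r n             ≡⟨ +m-+n≡+[m∸n] (cℕ-≤-r* n) ⟩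
      + (r * cℕ r (suc n) ∸ cℕ r n)                 ∎
    where open ≡-Reasoning

  Dy≡cℕ : ∀ m → Dy r (3 + m) ≡ cℕ r m
  Dy≡cℕ m = cong ∣_∣ (c≡cℕ m)

  Dx+Dy≡cℕ : ∀ m → Dx r (3 + m) + Dy r (3 + m) ≡ cℕ r (suc m)
  Dx+Dy≡cℕ m = begin
      Dx r (3 + m) + Dy r (3 + m)            ≡⟨ cong₂ (λ u v → ∣ u ℤ.- v ∣ + ∣ v ∣) (c≡cℕ (suc m)) (c≡cℕ m) ⟩
      ∣ + cℕ r (suc m) ℤ.- + cℕ r m ∣ + cℕ r m  ≡⟨ cong (λ z → ∣ z ∣ + cℕ r m) (+m-+n≡+[m∸n] (cℕ-mono m)) ⟩
      cℕ r (suc m) ∸ cℕ r m + cℕ r m          ≡⟨ m∸n+n≡m (cℕ-mono m) ⟩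
      cℕ r (suc m)                            ∎
    where open ≡-Reasoning

  module _ (m : ℕ) where

    private instance
      cℕ-suc-nonZero : NonZero (cℕ r (suc m))
      cℕ-suc-nonZero = cℕ-nonZero m

    𝒟-length : ∀ {p} → IsMaxDyck (Dx r (3 + m)) (Dy r (3 + m)) p → length p ≡ cℕ r (suc m)
    𝒟-length (dyck , _) = trans (dyck-length dyck) (Dx+Dy≡cℕ m)

    𝒟-height : ∀ {p} → IsMaxDyck (Dx r (3 + m)) (Dy r (3 + m)) p →
               ∀ {i} → i ≤ cℕ r (suc m) → height p i ≡ cℕ r m * i / cℕ r (suc m)
    𝒟-height {p} maximal {i} i≤s = begin
        height p i                   ≡⟨ maxDyck-height maximal (subst (i ≤_) (sym (Dx+Dy≡cℕ m)) i≤s) ⟩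
        Dy r (3 + m) * i / s         ≡⟨ cong (λ b → b * i / s) (Dy≡cℕ m) ⟩
        cℕ r m * i / s               ≡⟨ /-congʳ (Dx+Dy≡cℕ m) ⟩
        cℕ r m * i / cℕ r (suc m)    ∎
      where
      open ≡-Reasoning
      s : ℕ
      s = Dx r (3 + m) + Dy r (3 + m)
      instance
        s-nonZero : NonZero s
        s-nonZero = subst NonZero (sym (Dx+Dy≡cℕ m)) (cℕ-nonZero m)

-- A, B, G play c_{n-1}, c_{n-2}, c_{n-3}; j = x + y and k = rx + (r-1)y, with y = ⌊G j/B⌋.
module _ {A B G r : ℕ} .{{_ : NonZero A}} .{{_ : NonZero B}} (A+G≡r*B : A + G ≡ r * B)
         {j k : ℕ} (k+⌊Gj/B⌋≡r*j : k + G * j / B ≡ r * j) where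

  rescale-remainder : B * k ≡ G * j % B + j * A
  rescale-remainder = +-cancelʳ-≡ (B * y) (B * k) (d + j * A) (begin
      B * k + B * y      ≡⟨ *-distribˡ-+ B k y ⟨
      B * (k + y)        ≡⟨ cong (B *_) k+⌊Gj/B⌋≡r*j ⟩
      B * (r * j)        ≡⟨ ℕ-Solver.solve (B ∷ r ∷ j ∷ []) ⟩
      r * B * j          ≡⟨ cong (_* j) A+G≡r*B ⟨
      (A + G) * j        ≡⟨ *-distribʳ-+ j A G ⟩
      A * j + G * j      ≡⟨ cong (λ z → A * j + z) (m≡m%n+[m/n]*n (G * j) B) ⟩
      A * j + (d + y * B)  ≡⟨ rearrange A j d y B ⟩
      d + j * A + B * y  ∎)
    where
    open ≡-Reasoning
    y d : ℕ
    y = G * j / B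
    d = G * j % B
    rearrange : ∀ a j d y b → a * j + (d + y * b) ≡ d + j * a + b * y
    rearrange = ℕ-Solver.solve-∀

  module _ (B≤A : B ≤ A) where

    rescale-quotient : B * k / A ≡ j
    rescale-quotient = trans (/-congˡ rescale-remainder)
      (q*n≤m<[1+q]*n⇒m/n≡q (m≤n+m (j * A) (G * j % B))
        (+-monoˡ-< (j * A) (<-≤-trans (m%n<n (G * j) B) B≤A)))

    rescale-bound : j ≤ B → k ≤ A
    rescale-bound j≤B = s≤s⁻¹ (*-cancelˡ-< B k (suc A) (begin-strict
        B * k              ≡⟨ rescale-remainder ⟩
        G * j % B + j * A  <⟨ +-monoˡ-< (j * A) (m%n<n (G * j) B) ⟩
        B + j * A          ≤⟨ +-monoʳ-≤ B (*-monoˡ-≤ A j≤B) ⟩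
        B + B * A          ≡⟨ *-suc B A ⟨
        B * suc A          ∎))
      where open ≤-Reasoning

[x+y]-x≡y : ∀ (x y : ℤ) → x ℤ.+ y ℤ.- x ≡ y
[x+y]-x≡y = ℤ-Solver.solve-∀

π-vertex : ∀ r n p {i} → i ≤ length p →
           π r n p i ≡ + proj₁ (vertex p i) ℤ.* c r (n ∸ 2) ℤ.- + height p i ℤ.* (c r (n ∸ 1) ℤ.- c r (n ∸ 2))
π-vertex r n p {i} i≤|p| = cong (λ z → + x ℤ.* c r (n ∸ 2) ℤ.- z ℤ.* (c r (n ∸ 1) ℤ.- c r (n ∸ 2))) (begin
    + i ℤ.- + x          ≡⟨ cong (λ z → + z ℤ.- + x) (vertex-sum p i≤|p|) ⟨
    + x ℤ.+ + y ℤ.- + x  ≡⟨ [x+y]-x≡y (+ x) (+ y) ⟩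
    + y                  ∎)
  where
  open ≡-Reasoning
  x y : ℕ
  x = proj₁ (vertex p i)
  y = height p i

π-shift : ∀ (ρ u x y b g : ℤ) → u ℤ.+ (x ℤ.+ y) ℤ.+ y ≡ ρ ℤ.* (x ℤ.+ y) →
          u ℤ.* b ℤ.- (x ℤ.+ y) ℤ.* (ρ ℤ.* b ℤ.- g ℤ.- b) ≡ x ℤ.* g ℤ.- y ℤ.* (b ℤ.- g)
π-shift ρ u x y b g shift = begin
    u ℤ.* b ℤ.- (x ℤ.+ y) ℤ.* (ρ ℤ.* b ℤ.- g ℤ.- b)                  ≡⟨ expand ρ u x y b g ⟩
    R ℤ.+ (u ℤ.+ (x ℤ.+ y) ℤ.+ y ℤ.- ρ ℤ.* (x ℤ.+ y)) ℤ.* b          ≡⟨ cong (λ z → R ℤ.+ (z ℤ.- ρ ℤ.* (x ℤ.+ y)) ℤ.* b) shift ⟩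
    R ℤ.+ (ρ ℤ.* (x ℤ.+ y) ℤ.- ρ ℤ.* (x ℤ.+ y)) ℤ.* b               ≡⟨ cancel R (ρ ℤ.* (x ℤ.+ y)) b ⟩
    R                                                                ∎
  where
  open ≡-Reasoning
  R : ℤ
  R = x ℤ.* g ℤ.- y ℤ.* (b ℤ.- g)
  expand : ∀ ρ u x y b g → u ℤ.* b ℤ.- (x ℤ.+ y) ℤ.* (ρ ℤ.* b ℤ.- g ℤ.- b)
         ≡ x ℤ.* g ℤ.- y ℤ.* (b ℤ.- g) ℤ.+ (u ℤ.+ (x ℤ.+ y) ℤ.+ y ℤ.- ρ ℤ.* (x ℤ.+ y)) ℤ.* b
  expand = ℤ-Solver.solve-∀
  cancel : ∀ R z b → R ℤ.+ (z ℤ.- z) ℤ.* b ≡ R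
  cancel = ℤ-Solver.solve-∀

π-rescale : ∀ r m {P Q k i} → k ≤ length P → i ≤ length Q →
            height P k ≡ i → k + height Q i ≡ r * i → π r (3 + m) P k ≡ π r (2 + m) Q i
π-rescale r m {P} {Q} {k} {i} k≤|P| i≤|Q| yP≡i k+y≡r*i = begin
    π r (3 + m) P k                                     ≡⟨ π-vertex r (3 + m) P k≤|P| ⟩
    + xP ℤ.* b ℤ.- + height P k ℤ.* (c r (2 + m) ℤ.- b)  ≡⟨ cong (λ h → + xP ℤ.* b ℤ.- + h ℤ.* (c r (2 + m) ℤ.- b)) yP≡x+y ⟩
    + xP ℤ.* b ℤ.- (+ x ℤ.+ + y) ℤ.* (c r (2 + m) ℤ.- b) ≡⟨ π-shift (+ r) (+ xP) (+ x) (+ y) b g shift ⟩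
    + x ℤ.* g ℤ.- + y ℤ.* (b ℤ.- g)                    ≡⟨ π-vertex r (2 + m) Q i≤|Q| ⟨
    π r (2 + m) Q i                                     ∎
  where
  open ≡-Reasoning
  b g : ℤ
  b = c r (1 + m)
  g = c r m
  xP x y : ℕ
  xP = proj₁ (vertex P k)
  x = proj₁ (vertex Q i)
  y = height Q i
  yP≡x+y : height P k ≡ x + y
  yP≡x+y = trans yP≡i (sym (vertex-sum Q i≤|Q|))
  shiftℕ : xP + (x + y) + y ≡ r * (x + y)
  shiftℕ = begin
    xP + (x + y) + y         ≡⟨ cong (λ h → xP + h + y) yP≡x+y ⟨
    xP + height P k + y      ≡⟨ cong (_+ y) (vertex-sum P k≤|P|) ⟩
    k + y                    ≡⟨ k+y≡r*i ⟩
    r * i                    ≡⟨ cong (r *_) (vertex-sum Q i≤|Q|) ⟨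
    r * (x + y)              ∎
  shift : + xP ℤ.+ (+ x ℤ.+ + y) ℤ.+ + y ≡ + r ℤ.* (+ x ℤ.+ + y)
  shift = trans (cong +_ shiftℕ) (ℤP.pos-* r (x + y))

r*x+[r∸1]*y+y≡r*[x+y] : ∀ {r} → 1 ≤ r → ∀ x y → r * x + (r ∸ 1) * y + y ≡ r * (x + y)
r*x+[r∸1]*y+y≡r*[x+y] {suc r} _ x y = identity r x y
  where
  identity : ∀ r x y → suc r * x + r * y + y ≡ suc r * (x + y)
  identity = ℕ-Solver.solve-∀

lemma4p9 : (r n : ℕ) → 2 ≤ r → 4 ≤ n →
    (P Q : Path) → IsMaxDyck (Dx r n) (Dy r n) P → IsMaxDyck (Dx r (n ∸ 1)) (Dy r (n ∸ 1)) Q →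
    (i : ℕ) → i ≤ length Q →
      (r * proj₁ (vertex Q i) + (r ∸ 1) * proj₂ (vertex Q i) ≤ length P)
      × (π r n P (r * proj₁ (vertex Q i) + (r ∸ 1) * proj₂ (vertex Q i))
         ≡ π r (n ∸ 1) Q (proj₁ (vertex Q i) + proj₂ (vertex Q i)))
lemma4p9 r (suc (suc (suc (suc m)))) 2≤r (s≤s (s≤s (s≤s (s≤s _)))) P Q maxP maxQ i i≤|Q| =
  k≤|P| , trans (π-rescale r (suc m) k≤|P| i≤|Q| yP≡i k+y≡r*i) (cong (π r (3 + m) Q) (sym x+y≡i))
  where
  open Sequence 2≤r
  instance
    A-nonZero : NonZero (cℕ r (2 + m))
    A-nonZero = cℕ-nonZero (suc m)
    B-nonZero : NonZero (cℕ r (1 + m))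
    B-nonZero = cℕ-nonZero m
  x y k : ℕ
  x = proj₁ (vertex Q i)
  y = height Q i
  k = r * x + (r ∸ 1) * y
  x+y≡i : x + y ≡ i
  x+y≡i = vertex-sum Q i≤|Q|
  i≤B : i ≤ cℕ r (1 + m)
  i≤B = subst (i ≤_) (𝒟-length m maxQ) i≤|Q|
  k+y≡r*i : k + y ≡ r * i
  k+y≡r*i = trans (r*x+[r∸1]*y+y≡r*[x+y] (≤-trans (s≤s z≤n) 2≤r) x y) (cong (r *_) x+y≡i)
  k+⌊Gi/B⌋≡r*i : k + cℕ r m * i / cℕ r (1 + m) ≡ r * i
  k+⌊Gi/B⌋≡r*i = subst (λ h → k + h ≡ r * i) (𝒟-height m maxQ i≤B) k+y≡r*i
  k≤A : k ≤ cℕ r (2 + m)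
  k≤A = rescale-bound {r = r} (cℕ-rec m) k+⌊Gi/B⌋≡r*i (cℕ-mono (suc m)) i≤B
  k≤|P| : k ≤ length P
  k≤|P| = subst (k ≤_) (sym (𝒟-length (suc m) maxP)) k≤A
  yP≡i : height P k ≡ i
  yP≡i = trans (𝒟-height (suc m) maxP k≤A) (rescale-quotient {r = r} (cℕ-rec m) k+⌊Gi/B⌋≡r*i (cℕ-mono (suc m)))
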